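{- Let $V$ be a finite set with $|V|\geq 3$ and let $A=(a_{ij})_{i,j\in V}$, $B=(b_{ij})_{i,j\in V}$ be two dense skew-symmetric matrices. If $A^{\infty}$ and $B^{\infty}$ are $(\leq 4)$-HL-equivalent, then every equivalence class of $\mathcal{E}_{A,B}$ and every equivalence class of $\mathcal{D}_{A,B}$ is a clan of $A$ and a clan of $B$.
   Context: Throughout, matrices have entries in a field $\mathbb{K}$ of characteristic not equal to $2$. A matrix is dense if all its off-diagonal entries are nonzero. For a dense skew-symmetric matrix $A$ indexed by $V$, $A^{\infty}$ is the matrix indexed by $V\cup\{\infty\}$ ($\infty\notin V$) extending $A$ by $a_{\infty\infty}=0$, $a_{\infty y}=1$, $a_{y\infty}=-1$ for $y\in V$. Two matrices $M,N$ indexed by the same set $W$ are $(\leq k)$-HL-equivalent if $\det(M[X])=\det(N[X])$ for every $X\subseteq W$ with $|X|\leq k$, where $M[X]$ is the principal submatrix indexed by $X$. If dense skew-symmetric $A,B$ satisfy $b_{xy}\in\{a_{xy},-a_{xy}\}$ for all $x\neq y$ (which holds under the hypothesis), define equivalence relations on $V$: $x\,\mathcal{E}_{A,B}\,y$ iff $x=y$ or there is a sequence $x=x_0,x_1,\dots,x_n=y$ with $a_{x_tx_{t+1}}=b_{x_tx_{t+1}}$ for $t=0,\dots,n-1$; and $x\,\mathcal{D}_{A,B}\,y$ iff $x=y$ or there is such a sequence with $a_{x_tx_{t+1}}=-b_{x_tx_{t+1}}$ for all $t$. A subset $I\subseteq V$ is a clan of $A$ if for all $i,j\in I$ and $x\in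 V\setminus I$, $a_{xi}=a_{xj}$ and $a_{ix}=a_{jx}$. -}

module Defs where

open import Level using (Level; _⊔_)
open import Algebra.Bundles using (CommutativeRing)
open import Data.Nat using (ℕ; zero; suc; _≤_)
open import Data.Fin using (Fin; zero; suc; punchIn)
open import Data.Fin.Subset using (Subset; _∈_; _∉_)
open import Data.Bool using (true; false)
open import Data.Vec using (_∷_; [])
open import Data.List using (List; []; _∷_; length; lookup; map)
open import Data.Product using (Σ; _×_)
open import Relation.Nullary using (¬_)
open import Relation.Binary.PropositionalEquality using (_≡_)
open import Relation.Binary.Construct.Closure.ReflexiveTransitive using (Star)

record Field (c ℓ : Level) : Set (Level.suc (c ⊔ ℓ)) where
  field
    commutativeRing : CommutativeRing c ℓ
  open CommutativeRing commutativeRing public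
  field
    0≉1     : ¬ (0# ≈ 1#)
    inverse : ∀ x → ¬ (x ≈ 0#) → Σ Carrier (λ y → x * y ≈ 1#)

module _ {c ℓ : Level} (K : Field c ℓ) where
  open Field K using (Carrier; _≈_; _+_; _*_; -_; 0#; 1#)

  CharNot2 : Set ℓ
  CharNot2 = ¬ (1# + 1# ≈ 0#)

  Matrix : ℕ → Set c
  Matrix m = Fin m → Fin m → Carrier

  sumFin : ∀ {k} → (Fin k → Carrier) → Carrier
  sumFin {zero}  f = 0#
  sumFin {suc k} f = f zero + sumFin (λ i → f (suc i))

  sign : ∀ {k} → Fin k → Carrier
  sign zero    = 1#
  sign (suc j) = - sign j

  det : ∀ {k} → Matrix k → Carrier
  det {zero}  M = 1#
  det {suc k} M = sumFin (λ j → sign j * (M zero j * det (λ r s → M (suc r) (punchIn j s))))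

  members : ∀ {m} → Subset m → List (Fin m)
  members []          = []
  members (true ∷ X)  = zero ∷ map suc (members X)
  members (false ∷ X) = map suc (members X)

  detSub : ∀ {m} → Matrix m → Subset m → Carrier
  detSub M X = det (λ i j → M (lookup (members X) i) (lookup (members X) j))

  HLEquiv≤ : ℕ → ∀ {m} → Matrix m → Matrix m → Set ℓ
  HLEquiv≤ k {m} M N = (X : Subset m) → length (members X) ≤ k → detSub M X ≈ detSub N X

  SkewSymmetric : ∀ {n} → Matrix n → Set ℓ
  SkewSymmetric A = ∀ i j → A i j ≈ - A j i

  Dense : ∀ {n} → Matrix n → Set ℓ
  Dense A = ∀ i j → ¬ (i ≡ j) → ¬ (A i j ≈ 0#)

  -- A^∞ : the new index ∞ is  zero : Fin (suc n), and x ∈ V is  suc x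
  _^∞ : ∀ {n} → Matrix n → Matrix (suc n)
  (A ^∞) zero    zero    = 0#
  (A ^∞) zero    (suc y) = 1#
  (A ^∞) (suc x) zero    = - 1#
  (A ^∞) (suc x) (suc y) = A x y

  E-rel : ∀ {n} → Matrix n → Matrix n → Fin n → Fin n → Set ℓ
  E-rel A B = Star (λ x y → A x y ≈ B x y)

  D-rel : ∀ {n} → Matrix n → Matrix n → Fin n → Fin n → Set ℓ
  D-rel A B = Star (λ x y → A x y ≈ - B x y)

  IsClan : ∀ {n} {p} → Matrix n → (Fin n → Set p) → Set (ℓ ⊔ p)
  IsClan A I = ∀ i j x → I i → I j → ¬ I x → (A x i ≈ A x j) × (A i x ≈ A j x)

module Submission where

-- Skew-symmetry and characteristic ≠ 2 make A and B alternating, so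
-- principal minors of A^∞ of sizes 2 and 4 are squares of Pfaffians:
--   det A^∞[{x, y}] = a_xy² ,   det A^∞[{∞, i, j, u}] = (a_ij − a_iu + a_ju)² .
-- HL-equivalence therefore gives b_xy = ± a_xy and equal squared Pfaffians.
-- If a_km = b_km (an E-step) while b_ku = −a_ku and b_mu = −a_mu, the
-- Pfaffians give (x − y + z)² = (x + y − z)² with x = a_km ≠ 0, hence
-- y = z, i.e. a_ku = a_mu and b_ku = b_mu; D-steps are handled alike.  So a
-- point outside a class sees consecutive points of every path in the class
-- alike, hence all points of the class: the class is a clan.

open import Defs
open import Level using (Level)
open import Algebra.Bundles using (CommutativeRing; RawRing)
open import Data.Nat as ℕ using (ℕ; zero; suc; _≤_; z≤n; s≤s)
import Data.Nat.Properties as ℕ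
open import Data.Fin as Fin using (Fin; zero; suc; punchIn)
import Data.Fin.Properties as Fin
open import Data.Fin.Patterns using (0F; 1F; 2F; 3F; 4F; 5F)
open import Data.Product using (_×_; _,_; proj₁; proj₂)
open import Data.Maybe using (Maybe; just; nothing; is-just; to-witness-T)
open import Data.Bool using (T; true; false)
open import Data.List as List using (List; []; _∷_)
open import Data.List.Properties using (length-map)
open import Data.Vec as Vec using (Vec; []; _∷_; _[_]≔_)
import Data.Vec.Properties as Vec
open import Data.Fin.Subset using (Subset; ⊥)
open import Relation.Binary.PropositionalEquality as ≡ using (_≡_; _≢_)
open import Relation.Nullary using (¬_; yes; no)
open import Algebra.Solver.Ring.AlmostCommutativeRing
  using (fromCommutativeRing; _-Raw-AlmostCommutative⟶_)
open import Function using (_on_)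
open import Relation.Binary using (Rel; IsEquivalence; DecidableEquality)
open import Relation.Binary.Construct.Intersection as ∩ using (_∩_)
import Relation.Binary.Construct.On as On
open import Relation.Binary.Construct.Closure.ReflexiveTransitive using (Star; ε; _◅_; _◅◅_)

module IntegerCoefficientSolver {c ℓ : Level} (R : CommutativeRing c ℓ) where
  open CommutativeRing R
  open import Algebra.Properties.Semiring.Mult semiring renaming (_×_ to _×ₙ_) using (×-homo-+; ×1-homo-*)
  open import Algebra.Properties.Ring ring
    using (-‿distribˡ-*; -‿distribʳ-*; -‿involutive; -0#≈0#; -‿+-comm; ⁻¹-anti-homo‿-)
  open import Algebra.Properties.CommutativeSemigroup +-commutativeSemigroup using (interchange)
  open import Relation.Binary.Reasoning.Setoid setoid

  neg*neg : ∀ p q → - p * - q ≈ p * q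
  neg*neg p q = begin
    - p * - q     ≈⟨ -‿distribˡ-* p (- q) ⟨
    - (p * - q)   ≈⟨ -‿cong (-‿distribʳ-* p q) ⟨
    - - (p * q)   ≈⟨ -‿involutive (p * q) ⟩
    p * q         ∎

  -- The homomorphism laws of the interpretation below reduce to the
  -- following three identities of differences.
  difference-of-sums : ∀ p q r s → (p + q) - (r + s) ≈ (p - r) + (q - s)
  difference-of-sums p q r s = begin
    (p + q) - (r + s)     ≈⟨ +-congˡ (sym (-‿+-comm r s)) ⟩
    (p + q) + (- r + - s) ≈⟨ interchange p q (- r) (- s) ⟩
    (p - r) + (q - s)     ∎

  product-of-differences : ∀ p q r s → (p - q) * (r - s) ≈ (p * r + q * s) - (p * s + q * r)
  product-of-differences p q r s = begin
    (p - q) * (r - s)                               ≈⟨ distribʳ (r - s) p (- q) ⟩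
    p * (r - s) + - q * (r - s)                     ≈⟨ +-cong (distribˡ p r (- s)) (distribˡ (- q) r (- s)) ⟩
    (p * r + p * - s) + (- q * r + - q * - s)       ≈⟨ +-cong (+-congˡ (sym (-‿distribʳ-* p s))) (+-comm _ _) ⟩
    (p * r - p * s) + (- q * - s + - q * r)         ≈⟨ +-congˡ (+-cong (neg*neg q s) (sym (-‿distribˡ-* q r))) ⟩
    (p * r - p * s) + (q * s - q * r)               ≈⟨ interchange (p * r) (- (p * s)) (q * s) (- (q * r)) ⟩
    (p * r + q * s) + (- (p * s) + - (q * r))       ≈⟨ +-congˡ (-‿+-comm (p * s) (q * r)) ⟩
    (p * r + q * s) - (p * s + q * r)               ∎

  cross-equal⇒difference-equal : ∀ p q r s → p + s ≈ r + q → p - q ≈ r - s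
  cross-equal⇒difference-equal p q r s e = begin
    p - q                   ≈⟨ sym (+-identityʳ _) ⟩
    (p - q) + 0#            ≈⟨ +-congˡ (sym (-‿inverseʳ s)) ⟩
    (p - q) + (s - s)       ≈⟨ interchange p (- q) s (- s) ⟩
    (p + s) + (- q + - s)   ≈⟨ +-cong e (+-comm (- q) (- s)) ⟩
    (r + q) + (- s + - q)   ≈⟨ interchange r q (- s) (- q) ⟩
    (r - s) + (q - q)       ≈⟨ +-congˡ (-‿inverseʳ q) ⟩
    (r - s) + 0#            ≈⟨ +-identityʳ _ ⟩
    r - s                   ∎

  -- (a , b) stands for the integer a − b
  ℤ-as-differences : RawRing _ _
  ℤ-as-differences = record
    { Carrier = ℕ × ℕ
    ; _≈_     = _≡_
    ; _+_     = λ { (a , b) (c , d) → (a ℕ.+ c , b ℕ.+ d) }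
    ; _*_     = λ { (a , b) (c , d) → (a ℕ.* c ℕ.+ b ℕ.* d , a ℕ.* d ℕ.+ b ℕ.* c) }
    ; -_      = λ { (a , b) → (b , a) }
    ; 0#      = (0 , 0)
    ; 1#      = (1 , 0)
    }

  ⟦_⟧ᶜ : ℕ × ℕ → Carrier
  ⟦ (a , b) ⟧ᶜ = a ×ₙ 1# - b ×ₙ 1#

  ⟦0⟧ : ⟦ (0 , 0) ⟧ᶜ ≈ 0#
  ⟦0⟧ = -‿inverseʳ 0#

  ⟦1⟧ : ⟦ (1 , 0) ⟧ᶜ ≈ 1#
  ⟦1⟧ = trans (+-congʳ (+-identityʳ 1#)) (trans (+-congˡ -0#≈0#) (+-identityʳ 1#))

  interpretation : ℤ-as-differences -Raw-AlmostCommutative⟶ fromCommutativeRing R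
  interpretation = record
    { ⟦_⟧    = ⟦_⟧ᶜ
    ; +-homo = λ { (a , b) (c , d) →
        trans (+-cong (×-homo-+ 1# a c) (-‿cong (×-homo-+ 1# b d))) (difference-of-sums _ _ _ _) }
    ; *-homo = λ { (a , b) (c , d) →
        trans (+-cong (trans (×-homo-+ 1# (a ℕ.* c) (b ℕ.* d)) (+-cong (×1-homo-* a c) (×1-homo-* b d)))
                      (-‿cong (trans (×-homo-+ 1# (a ℕ.* d) (b ℕ.* c)) (+-cong (×1-homo-* a d) (×1-homo-* b c)))))
              (sym (product-of-differences _ _ _ _)) }
    ; -‿homo = λ { (a , b) → sym (⁻¹-anti-homo‿- (a ×ₙ 1#) (b ×ₙ 1#)) }
    ; 0-homo = ⟦0⟧
    ; 1-homo = ⟦1⟧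
    }

  _≟ᶜ_ : ∀ x y → Maybe (⟦ x ⟧ᶜ ≈ ⟦ y ⟧ᶜ)
  (a , b) ≟ᶜ (c , d) with a ℕ.+ d ℕ.≟ c ℕ.+ b
  ... | yes e = just (cross-equal⇒difference-equal _ _ _ _
                (trans (sym (×-homo-+ 1# a d)) (trans (reflexive (≡.cong (_×ₙ 1#) e)) (×-homo-+ 1# c b))))
  ... | no _  = nothing

  open import Algebra.Solver.Ring ℤ-as-differences (fromCommutativeRing R) interpretation _≟ᶜ_ public

  -- two polynomials with equal normal forms denote equal functions;
  -- the normal-form comparison is run by the type checker
  ring-identity : ∀ {n} (p q : Polynomial n) {same : T (is-just (normalise p ≟N normalise q))} →
                  ∀ ρ → ⟦ p ⟧ ρ ≈ ⟦ q ⟧ ρ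
  ring-identity p q {same} ρ = prove ρ p q (⟦ to-witness-T _ same ⟧N-cong ρ)

  X Y Z : Polynomial 3
  X = var 0F
  Y = var 1F
  Z = var 2F

module Determinants {c ℓ : Level} (K : Field c ℓ) where
  open Field K hiding (zero)
  open IntegerCoefficientSolver commutativeRing
  open import Algebra.Properties.Ring ring using (-‿involutive; -0#≈0#)
  open import Relation.Binary.Reasoning.Setoid setoid

  sumFin-cong : ∀ {k} {f g : Fin k → Carrier} → (∀ i → f i ≈ g i) → sumFin K f ≈ sumFin K g
  sumFin-cong {zero}  f≈g = refl
  sumFin-cong {suc k} f≈g = +-cong (f≈g zero) (sumFin-cong (λ i → f≈g (suc i)))

  minor : ∀ {k} → Matrix K (suc k) → Fin (suc k) → Matrix K k
  minor M j r s = M (suc r) (punchIn j s)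

  expansion-term : ∀ {k} → Matrix K (suc k) → Fin (suc k) → Carrier
  expansion-term M j = sign K j * (M zero j * det K (minor M j))

  det-cong : ∀ {k} {M N : Matrix K k} → (∀ i j → M i j ≈ N i j) → det K M ≈ det K N
  det-cong {zero}  M≈N = refl
  det-cong {suc k} {M} {N} M≈N = sumFin-cong {f = expansion-term M} {g = expansion-term N} (λ j →
    *-congˡ (*-cong (M≈N zero j) (det-cong (λ r s → M≈N (suc r) (punchIn j s)))))

  -- The Laplace expansion of `det`, carried out on matrices of polynomials,
  -- so that determinant identities can be handed to the ring solver.
  sumᴾ : ∀ {n k} → (Fin k → Polynomial n) → Polynomial n
  sumᴾ {k = zero}  f = con (0 , 0)
  sumᴾ {k = suc k} f = f zero :+ sumᴾ (λ i → f (suc i))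

  signᴾ : ∀ {n k} → Fin k → Polynomial n
  signᴾ zero    = con (1 , 0)
  signᴾ (suc j) = :- signᴾ j

  mutual
    detᴾ : ∀ {n k} → (Fin k → Fin k → Polynomial n) → Polynomial n
    detᴾ {k = zero}  P = con (1 , 0)
    detᴾ {k = suc k} P = sumᴾ (expansion-termᴾ P)

    expansion-termᴾ : ∀ {n k} → (Fin (suc k) → Fin (suc k) → Polynomial n) → Fin (suc k) → Polynomial n
    expansion-termᴾ P j = signᴾ j :* (P zero j :* detᴾ (λ r s → P (suc r) (punchIn j s)))

  sumᴾ-correct : ∀ {n k} (f : Fin k → Polynomial n) ρ → ⟦ sumᴾ f ⟧ ρ ≈ sumFin K (λ i → ⟦ f i ⟧ ρ)
  sumᴾ-correct {k = zero}  f ρ = ⟦0⟧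
  sumᴾ-correct {k = suc k} f ρ = +-congˡ (sumᴾ-correct (λ i → f (suc i)) ρ)

  signᴾ-correct : ∀ {n k} (j : Fin k) (ρ : Vec Carrier n) → ⟦ signᴾ j ⟧ ρ ≈ sign K j
  signᴾ-correct zero    ρ = ⟦1⟧
  signᴾ-correct (suc j) ρ = -‿cong (signᴾ-correct j ρ)

  detᴾ-correct : ∀ {n k} (P : Fin k → Fin k → Polynomial n) ρ →
                 ⟦ detᴾ P ⟧ ρ ≈ det K (λ i j → ⟦ P i j ⟧ ρ)
  detᴾ-correct {k = zero}  P ρ = ⟦1⟧
  detᴾ-correct {k = suc k} P ρ = trans (sumᴾ-correct (expansion-termᴾ P) ρ) (sumFin-cong
    {f = λ j → ⟦ expansion-termᴾ P j ⟧ ρ} {g = expansion-term (λ i j → ⟦ P i j ⟧ ρ)} (λ j →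
    *-cong (signᴾ-correct j ρ) (*-congˡ (detᴾ-correct (λ r s → P (suc r) (punchIn j s)) ρ))))

  Alternating : ∀ {m} → Matrix K m → Set ℓ
  Alternating M = SkewSymmetric K M × (∀ i → M i i ≈ 0#)

  detOn : ∀ {m} → Matrix K m → List (Fin m) → Carrier
  detOn M l = det K (λ a b → M (List.lookup l a) (List.lookup l b))

  square : Carrier → Carrier
  square t = t * t

  square-cong : ∀ {a b} → a ≈ b → square a ≈ square b
  square-cong a≈b = *-cong a≈b a≈b

  square-neg : ∀ a → square (- a) ≈ square a
  square-neg a = neg*neg a a

  pfaffian₄ : ∀ {m} → Matrix K m → (p q r s : Fin m) → Carrier
  pfaffian₄ M p q r s = M p q * M r s - M p r * M q s + M p s * M q r

  det-alternating₂ : ∀ {m} {M : Matrix K m} → Alternating M → ∀ p q →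
                     detOn M (p ∷ q ∷ []) ≈ square (M p q)
  det-alternating₂ {M = M} (skew , diag) p q = begin
    detOn M (p ∷ q ∷ [])                ≈⟨ det-cong entry ⟩
    det K (λ a b → ⟦ generic a b ⟧ ρ)   ≈⟨ detᴾ-correct generic ρ ⟨
    ⟦ detᴾ generic ⟧ ρ                  ≈⟨ ring-identity (detᴾ generic) (x₀₁ :* x₀₁) ρ ⟩
    square (M p q)                      ∎
    where
    ρ : Vec Carrier 1
    ρ = M p q ∷ []
    x₀₁ : Polynomial 1
    x₀₁ = var 0F
    generic : Fin 2 → Fin 2 → Polynomial 1
    generic 0F 0F = con (0 , 0)
    generic 0F 1F = x₀₁
    generic 1F 0F = :- x₀₁
    generic 1F 1F = con (0 , 0)
    entry : ∀ a b → M (List.lookup (p ∷ q ∷ []) a) (List.lookup (p ∷ q ∷ []) b) ≈ ⟦ generic a b ⟧ ρ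
    entry 0F 0F = trans (diag p) (sym ⟦0⟧)
    entry 0F 1F = refl
    entry 1F 0F = skew q p
    entry 1F 1F = trans (diag q) (sym ⟦0⟧)

  x₀₁ x₀₂ x₀₃ x₁₂ x₁₃ x₂₃ : Polynomial 6
  x₀₁ = var 0F
  x₀₂ = var 1F
  x₀₃ = var 2F
  x₁₂ = var 3F
  x₁₃ = var 4F
  x₂₃ = var 5F

  generic₄ : Fin 4 → Fin 4 → Polynomial 6
  generic₄ 0F 0F = con (0 , 0)
  generic₄ 0F 1F = x₀₁
  generic₄ 0F 2F = x₀₂
  generic₄ 0F 3F = x₀₃
  generic₄ 1F 0F = :- x₀₁
  generic₄ 1F 1F = con (0 , 0)
  generic₄ 1F 2F = x₁₂
  generic₄ 1F 3F = x₁₃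
  generic₄ 2F 0F = :- x₀₂
  generic₄ 2F 1F = :- x₁₂
  generic₄ 2F 2F = con (0 , 0)
  generic₄ 2F 3F = x₂₃
  generic₄ 3F 0F = :- x₀₃
  generic₄ 3F 1F = :- x₁₃
  generic₄ 3F 2F = :- x₂₃
  generic₄ 3F 3F = con (0 , 0)

  pfaffianᴾ₄ : Polynomial 6
  pfaffianᴾ₄ = x₀₁ :* x₂₃ :- x₀₂ :* x₁₃ :+ x₀₃ :* x₁₂

  upper-entries : ∀ {m} → Matrix K m → (p q r s : Fin m) → Vec Carrier 6
  upper-entries M p q r s = M p q ∷ M p r ∷ M p s ∷ M q r ∷ M q s ∷ M r s ∷ []

  alternating-entries₄ : ∀ {m} {M : Matrix K m} → Alternating M → ∀ p q r s a b →
    let l = p ∷ q ∷ r ∷ s ∷ [] in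
    M (List.lookup l a) (List.lookup l b) ≈ ⟦ generic₄ a b ⟧ (upper-entries M p q r s)
  alternating-entries₄ (skew , diag) p q r s 0F 0F = trans (diag p) (sym ⟦0⟧)
  alternating-entries₄ (skew , diag) p q r s 0F 1F = refl
  alternating-entries₄ (skew , diag) p q r s 0F 2F = refl
  alternating-entries₄ (skew , diag) p q r s 0F 3F = refl
  alternating-entries₄ (skew , diag) p q r s 1F 0F = skew q p
  alternating-entries₄ (skew , diag) p q r s 1F 1F = trans (diag q) (sym ⟦0⟧)
  alternating-entries₄ (skew , diag) p q r s 1F 2F = refl
  alternating-entries₄ (skew , diag) p q r s 1F 3F = refl
  alternating-entries₄ (skew , diag) p q r s 2F 0F = skew r p
  alternating-entries₄ (skew , diag) p q r s 2F 1F = skew r q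
  alternating-entries₄ (skew , diag) p q r s 2F 2F = trans (diag r) (sym ⟦0⟧)
  alternating-entries₄ (skew , diag) p q r s 2F 3F = refl
  alternating-entries₄ (skew , diag) p q r s 3F 0F = skew s p
  alternating-entries₄ (skew , diag) p q r s 3F 1F = skew s q
  alternating-entries₄ (skew , diag) p q r s 3F 2F = skew s r
  alternating-entries₄ (skew , diag) p q r s 3F 3F = trans (diag s) (sym ⟦0⟧)

  det-alternating₄ : ∀ {m} {M : Matrix K m} → Alternating M → ∀ p q r s →
                     detOn M (p ∷ q ∷ r ∷ s ∷ []) ≈ square (pfaffian₄ M p q r s)
  det-alternating₄ {M = M} altM p q r s = begin
    detOn M (p ∷ q ∷ r ∷ s ∷ [])         ≈⟨ det-cong (alternating-entries₄ altM p q r s) ⟩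
    det K (λ a b → ⟦ generic₄ a b ⟧ ρ)   ≈⟨ detᴾ-correct generic₄ ρ ⟨
    ⟦ detᴾ generic₄ ⟧ ρ                  ≈⟨ ring-identity (detᴾ generic₄) (pfaffianᴾ₄ :* pfaffianᴾ₄) ρ ⟩
    square (pfaffian₄ M p q r s)         ∎
    where ρ : Vec Carrier 6
          ρ = upper-entries M p q r s

  ∞-alternating : ∀ {m} {A : Matrix K m} → Alternating A → Alternating (_^∞ K A)
  ∞-alternating {A = A} (skew , diag) = skew∞ , diag∞
    where
    skew∞ : SkewSymmetric K (_^∞ K A)
    skew∞ zero    zero    = sym -0#≈0#
    skew∞ zero    (suc y) = sym (-‿involutive 1#)
    skew∞ (suc x) zero    = refl
    skew∞ (suc x) (suc y) = skew x y
    diag∞ : ∀ i → _^∞ K A i i ≈ 0#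
    diag∞ zero    = refl
    diag∞ (suc i) = diag i

  -- The Pfaffian of A^∞ on (∞, p, q, r) is  a_pq − a_pr + a_qr.
  pf : Carrier → Carrier → Carrier → Carrier
  pf x y z = x - y + z

  pf-cong : ∀ {x x′ y y′ z z′} → x ≈ x′ → y ≈ y′ → z ≈ z′ → pf x y z ≈ pf x′ y′ z′
  pf-cong x≈ y≈ z≈ = +-cong (+-cong x≈ (-‿cong y≈)) z≈

  pfaffian∞ : ∀ {m} → Matrix K m → (p q r : Fin m) → Carrier
  pfaffian∞ A p q r = pf (A p q) (A p r) (A q r)

  pfᴾ : Polynomial 3 → Polynomial 3 → Polynomial 3 → Polynomial 3
  pfᴾ a b c = a :- b :+ c

  det∞₄ : ∀ {m} {A : Matrix K m} → Alternating A → ∀ p q r →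
          detOn (_^∞ K A) (zero ∷ suc p ∷ suc q ∷ suc r ∷ []) ≈ square (pfaffian∞ A p q r)
  det∞₄ {A = A} altA p q r = begin
    detOn (_^∞ K A) (zero ∷ suc p ∷ suc q ∷ suc r ∷ [])          ≈⟨ det-alternating₄ (∞-alternating altA) zero (suc p) (suc q) (suc r) ⟩
    square (1# * A q r - 1# * A p r + 1# * A p q)                  ≈⟨ square-cong (pf-cong (*-identityˡ _) (*-identityˡ _) (*-identityˡ _)) ⟩
    square (pf (A q r) (A p r) (A p q))                            ≈⟨ square-cong (ring-identity (pfᴾ Z Y X) (pfᴾ X Y Z) ρ) ⟩
    square (pfaffian∞ A p q r)                                     ∎
    where ρ : Vec Carrier 3
          ρ = A p q ∷ A p r ∷ A q r ∷ []

  pfaffian∞-swap₁₂ : ∀ {m} {A : Matrix K m} → SkewSymmetric K A → ∀ p q r →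
                     square (pfaffian∞ A q p r) ≈ square (pfaffian∞ A p q r)
  pfaffian∞-swap₁₂ {A = A} skew p q r = begin
    square (pf (A q p) (A q r) (A p r))        ≈⟨ square-cong (pf-cong (skew q p) refl refl) ⟩
    square (pf (- A p q) (A q r) (A p r))      ≈⟨ square-cong (ring-identity (pfᴾ (:- X) Z Y) (:- pfᴾ X Y Z) ρ) ⟩
    square (- pfaffian∞ A p q r)               ≈⟨ square-neg _ ⟩
    square (pfaffian∞ A p q r)                 ∎
    where ρ : Vec Carrier 3
          ρ = A p q ∷ A p r ∷ A q r ∷ []

  pfaffian∞-swap₂₃ : ∀ {m} {A : Matrix K m} → SkewSymmetric K A → ∀ p q r →
                     square (pfaffian∞ A p r q) ≈ square (pfaffian∞ A p q r)
  pfaffian∞-swap₂₃ {A = A} skew p q r = begin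
    square (pf (A p r) (A p q) (A r q))        ≈⟨ square-cong (pf-cong refl refl (skew r q)) ⟩
    square (pf (A p r) (A p q) (- A q r))      ≈⟨ square-cong (ring-identity (pfᴾ Y X (:- Z)) (:- pfᴾ X Y Z) ρ) ⟩
    square (- pfaffian∞ A p q r)               ≈⟨ square-neg _ ⟩
    square (pfaffian∞ A p q r)                 ∎
    where ρ : Vec Carrier 3
          ρ = A p q ∷ A p r ∷ A q r ∷ []

data Inserted {a} {A : Set a} (k : A) : List A → List A → Set a where
  here  : ∀ {l} → Inserted k l (k ∷ l)
  there : ∀ {x l l′} → Inserted k l l′ → Inserted k (x ∷ l) (x ∷ l′)

Inserted-map : ∀ {a b} {A : Set a} {B : Set b} (f : A → B) {k : A} {l l′ : List A} →
               Inserted k l l′ → Inserted (f k) (List.map f l) (List.map f l′)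
Inserted-map f here      = here
Inserted-map f (there i) = there (Inserted-map f i)

Inserted-length : ∀ {a} {A : Set a} {k : A} {l l′ : List A} →
                  Inserted k l l′ → List.length l′ ≡ suc (List.length l)
Inserted-length here      = ≡.refl
Inserted-length (there i) = ≡.cong suc (Inserted-length i)

-- The sorted member lists of the subsets {p}, {p, q} and {p, q, r} of Fin m:
-- each new element is inserted into the member list of the smaller subset.
module SubsetMembers {c ℓ : Level} (K : Field c ℓ) where

  members-⊥ : ∀ {m} → members K (⊥ {m}) ≡ []
  members-⊥ {zero}  = ≡.refl
  members-⊥ {suc m} = ≡.cong (List.map suc) (members-⊥ {m})

  members-insert : ∀ {m} (k : Fin m) (X : Subset m) → Vec.lookup X k ≡ false →
                   Inserted k (members K X) (members K (X [ k ]≔ true))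
  members-insert zero    (false ∷ X) k∉X = here
  members-insert (suc k) (true ∷ X)  k∉X = there (Inserted-map suc (members-insert k X k∉X))
  members-insert (suc k) (false ∷ X) k∉X = Inserted-map suc (members-insert k X k∉X)

  pair : ∀ {m} → Fin m → Fin m → Subset m
  pair p q = ⊥ [ p ]≔ true [ q ]≔ true

  triple : ∀ {m} → Fin m → Fin m → Fin m → Subset m
  triple p q r = pair p q [ r ]≔ true

  members-singleton : ∀ {m} (p : Fin m) → members K (⊥ [ p ]≔ true) ≡ p ∷ []
  members-singleton zero    = ≡.cong (zero ∷_) (≡.cong (List.map suc) members-⊥)
  members-singleton (suc p) = ≡.cong (List.map suc) (members-singleton p)

  members-pair : ∀ {m} {p q : Fin m} → q ≢ p → Inserted q (p ∷ []) (members K (pair p q))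
  members-pair {p = p} {q} q≢p = ≡.subst (λ l → Inserted q l (members K (pair p q)))
    (members-singleton p)
    (members-insert q (⊥ [ p ]≔ true) (≡.trans (Vec.lookup∘update′ q≢p ⊥ true) (Vec.lookup-replicate q false)))

  members-triple : ∀ {m} {p q r : Fin m} → r ≢ p → r ≢ q →
                   Inserted r (members K (pair p q)) (members K (triple p q r))
  members-triple {p = p} {q} {r} r≢p r≢q = members-insert r (pair p q)
    (≡.trans (Vec.lookup∘update′ r≢q (⊥ [ p ]≔ true) true)
      (≡.trans (Vec.lookup∘update′ r≢p ⊥ true) (Vec.lookup-replicate r false)))

-- The principal minors of A^∞ of size 2 and 4 (containing ∞), for every
-- order in which the member list of the index set may list its elements.
module MinorsOf∞ {c ℓ : Level} (K : Field c ℓ) where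
  open Field K hiding (zero)
  open Determinants K
  open import Relation.Binary.Reasoning.Setoid setoid

  det∞-pair : ∀ {m} {M : Matrix K m} {p q : Fin m} {l} → Alternating M → Inserted q (p ∷ []) l →
              detOn (_^∞ K M) (List.map suc l) ≈ square (M p q)
  det∞-pair {M = M} {p} {q} altM here = begin
    detOn (_^∞ K M) (suc q ∷ suc p ∷ [])  ≈⟨ det-alternating₂ (∞-alternating altM) (suc q) (suc p) ⟩
    square (M q p)                        ≈⟨ square-cong (proj₁ altM q p) ⟩
    square (- M p q)                      ≈⟨ square-neg (M p q) ⟩
    square (M p q)                        ∎
  det∞-pair {p = p} {q} altM (there here) = det-alternating₂ (∞-alternating altM) (suc p) (suc q)

  det∞-triple : ∀ {m} {M : Matrix K m} {i j u : Fin m} {l₂ l} → Alternating M →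
                Inserted j (i ∷ []) l₂ → Inserted u l₂ l →
                detOn (_^∞ K M) (zero ∷ List.map suc l) ≈ square (pfaffian∞ M i j u)
  det∞-triple {M = M} {i} {j} {u} altM here here = begin
    detOn (_^∞ K M) (zero ∷ suc u ∷ suc j ∷ suc i ∷ [])   ≈⟨ det∞₄ altM u j i ⟩
    square (pfaffian∞ M u j i)                              ≈⟨ pfaffian∞-swap₁₂ (proj₁ altM) j u i ⟩
    square (pfaffian∞ M j u i)                              ≈⟨ pfaffian∞-swap₂₃ (proj₁ altM) j i u ⟩
    square (pfaffian∞ M j i u)                              ≈⟨ pfaffian∞-swap₁₂ (proj₁ altM) i j u ⟩
    square (pfaffian∞ M i j u)                              ∎
  det∞-triple {M = M} {i} {j} {u} altM here (there here) = begin
    detOn (_^∞ K M) (zero ∷ suc j ∷ suc u ∷ suc i ∷ [])   ≈⟨ det∞₄ altM j u i ⟩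
    square (pfaffian∞ M j u i)                              ≈⟨ pfaffian∞-swap₂₃ (proj₁ altM) j i u ⟩
    square (pfaffian∞ M j i u)                              ≈⟨ pfaffian∞-swap₁₂ (proj₁ altM) i j u ⟩
    square (pfaffian∞ M i j u)                              ∎
  det∞-triple {M = M} {i} {j} {u} altM here (there (there here)) = begin
    detOn (_^∞ K M) (zero ∷ suc j ∷ suc i ∷ suc u ∷ [])   ≈⟨ det∞₄ altM j i u ⟩
    square (pfaffian∞ M j i u)                              ≈⟨ pfaffian∞-swap₁₂ (proj₁ altM) i j u ⟩
    square (pfaffian∞ M i j u)                              ∎
  det∞-triple {M = M} {i} {j} {u} altM (there here) here = begin
    detOn (_^∞ K M) (zero ∷ suc u ∷ suc i ∷ suc j ∷ [])   ≈⟨ det∞₄ altM u i j ⟩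
    square (pfaffian∞ M u i j)                              ≈⟨ pfaffian∞-swap₁₂ (proj₁ altM) i u j ⟩
    square (pfaffian∞ M i u j)                              ≈⟨ pfaffian∞-swap₂₃ (proj₁ altM) i j u ⟩
    square (pfaffian∞ M i j u)                              ∎
  det∞-triple {M = M} {i} {j} {u} altM (there here) (there here) = begin
    detOn (_^∞ K M) (zero ∷ suc i ∷ suc u ∷ suc j ∷ [])   ≈⟨ det∞₄ altM i u j ⟩
    square (pfaffian∞ M i u j)                              ≈⟨ pfaffian∞-swap₂₃ (proj₁ altM) i j u ⟩
    square (pfaffian∞ M i j u)                              ∎
  det∞-triple {i = i} {j} {u} altM (there here) (there (there here)) = det∞₄ altM i j u

module FieldFacts {c ℓ : Level} (K : Field c ℓ) where
  open Field K hiding (zero)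
  open Determinants K using (Alternating; square; square-cong; square-neg; pf; pfᴾ)
  open IntegerCoefficientSolver commutativeRing using (X; Y; Z; _:+_; _:-_; _:*_; :-_; ring-identity)
  open import Algebra.Properties.Ring ring using (x∙y⁻¹≈ε⇒x≈y; x≈y⇒x∙y⁻¹≈ε; +-inverseˡ-unique)
  open import Relation.Binary.Reasoning.Setoid setoid

  nonzero-cancel : ∀ {a b} → ¬ a ≈ 0# → a * b ≈ 0# → b ≈ 0#
  nonzero-cancel {a} {b} a≉0 ab≈0 with inverse a a≉0
  ... | a⁻¹ , aa⁻¹≈1 = begin
    b                ≈⟨ *-identityˡ b ⟨
    1# * b           ≈⟨ *-congʳ aa⁻¹≈1 ⟨
    (a * a⁻¹) * b    ≈⟨ *-congʳ (*-comm a a⁻¹) ⟩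
    (a⁻¹ * a) * b    ≈⟨ *-assoc a⁻¹ a b ⟩
    a⁻¹ * (a * b)    ≈⟨ *-congˡ ab≈0 ⟩
    a⁻¹ * 0#         ≈⟨ zeroʳ a⁻¹ ⟩
    0#               ∎

  difference-of-squares : ∀ a b → (a - b) * (a + b) ≈ square a - square b
  difference-of-squares a b = ring-identity ((X :- Y) :* (X :+ Y)) (X :* X :- Y :* Y) (a ∷ b ∷ b ∷ [])

  squares-equal : ∀ {a b} → square a ≈ square b → ¬ a + b ≈ 0# → a ≈ b
  squares-equal {a} {b} a²≈b² a+b≉0 = x∙y⁻¹≈ε⇒x≈y a b (nonzero-cancel a+b≉0
    (trans (*-comm (a + b) (a - b)) (trans (difference-of-squares a b) (x≈y⇒x∙y⁻¹≈ε a²≈b²))))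

  squares-opposite : ∀ {a b} → square a ≈ square b → ¬ a ≈ b → a ≈ - b
  squares-opposite {a} {b} a²≈b² a≉b = +-inverseˡ-unique a b (nonzero-cancel
    (λ a-b≈0 → a≉b (x∙y⁻¹≈ε⇒x≈y a b a-b≈0))
    (trans (difference-of-squares a b) (x≈y⇒x∙y⁻¹≈ε a²≈b²)))

  module _ (char≠2 : CharNot2 K) where

    double-zero : ∀ {t} → t + t ≈ 0# → t ≈ 0#
    double-zero {t} t+t≈0 = nonzero-cancel char≠2 (begin
      (1# + 1#) * t    ≈⟨ distribʳ t 1# 1# ⟩
      1# * t + 1# * t  ≈⟨ +-cong (*-identityˡ t) (*-identityˡ t) ⟩
      t + t            ≈⟨ t+t≈0 ⟩
      0#               ∎)

    skew⇒alternating : ∀ {m} {M : Matrix K m} → SkewSymmetric K M → Alternating M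
    skew⇒alternating {M = M} skew = skew , λ i → double-zero (trans (+-congˡ (skew i i)) (-‿inverseʳ (M i i)))

    -- If x ≠ 0 and changing the signs of y and z leaves the square of
    -- x − y + z unchanged, then y = z: the sum of the two values is 2x ≠ 0,
    -- so they are equal, and their difference is 2(z − y).
    pf-sign-change : ∀ {x y z} → ¬ x ≈ 0# → square (pf x y z) ≈ square (pf x (- y) (- z)) → y ≈ z
    pf-sign-change {x} {y} {z} x≉0 squares≈ = sym (x∙y⁻¹≈ε⇒x≈y z y (double-zero (begin
      (z - y) + (z - y)                 ≈⟨ ring-identity ((Z :- Y) :+ (Z :- Y)) (pfᴾ X Y Z :- pfᴾ X (:- Y) (:- Z)) ρ ⟩
      pf x y z - pf x (- y) (- z)       ≈⟨ x≈y⇒x∙y⁻¹≈ε (squares-equal squares≈ sum≉0) ⟩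
      0#                                ∎)))
      where
      ρ : Vec Carrier 3
      ρ = x ∷ y ∷ z ∷ []
      sum≉0 : ¬ pf x y z + pf x (- y) (- z) ≈ 0#
      sum≉0 sum≈0 = x≉0 (double-zero (trans
        (ring-identity (X :+ X) (pfᴾ X Y Z :+ pfᴾ X (:- Y) (:- Z)) ρ) sum≈0))

    pf-sign-change′ : ∀ {x y z} → ¬ x ≈ 0# → square (pf x y z) ≈ square (pf (- x) y z) → y ≈ z
    pf-sign-change′ {x} {y} {z} x≉0 squares≈ = pf-sign-change x≉0 (begin
      square (pf x y z)                 ≈⟨ squares≈ ⟩
      square (pf (- x) y z)             ≈⟨ square-cong (ring-identity (:- X :- Y :+ Z) (:- (X :- :- Y :+ :- Z)) (x ∷ y ∷ z ∷ [])) ⟩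
      square (- pf x (- y) (- z))       ≈⟨ square-neg _ ⟩
      square (pf x (- y) (- z))         ∎)

module HLConsequences {c ℓ : Level} (K : Field c ℓ) {n : ℕ} {A B : Matrix K n}
                      (altA : Determinants.Alternating K A) (altB : Determinants.Alternating K B)
                      (hl : HLEquiv≤ K 4 (_^∞ K A) (_^∞ K B)) where
  open Field K hiding (zero)
  open Determinants K
  open SubsetMembers K
  open MinorsOf∞ K
  open import Relation.Binary.Reasoning.Setoid setoid

  entries-square : ∀ {p q} → q ≢ p → square (A p q) ≈ square (B p q)
  entries-square {p} {q} q≢p = begin
    square (A p q)                          ≈⟨ det∞-pair altA listing ⟨
    detSub K (_^∞ K A) (false ∷ pair p q)   ≈⟨ hl (false ∷ pair p q) size≤4 ⟩
    detSub K (_^∞ K B) (false ∷ pair p q)   ≈⟨ det∞-pair altB listing ⟩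
    square (B p q)                          ∎
    where
    listing : Inserted q (p ∷ []) (members K (pair p q))
    listing = members-pair q≢p
    size≤4 : List.length (members K (false ∷ pair p q)) ≤ 4
    size≤4 = ≡.subst (_≤ 4)
      (≡.sym (≡.trans (length-map suc (members K (pair p q))) (Inserted-length listing)))
      (s≤s (s≤s z≤n))

  pfaffians-square : ∀ {i j u} → j ≢ i → u ≢ i → u ≢ j →
                     square (pfaffian∞ A i j u) ≈ square (pfaffian∞ B i j u)
  pfaffians-square {i} {j} {u} j≢i u≢i u≢j = begin
    square (pfaffian∞ A i j u)                  ≈⟨ det∞-triple altA listing₂ listing₃ ⟨
    detSub K (_^∞ K A) (true ∷ triple i j u)    ≈⟨ hl (true ∷ triple i j u) size≤4 ⟩
    detSub K (_^∞ K B) (true ∷ triple i j u)    ≈⟨ det∞-triple altB listing₂ listing₃ ⟩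
    square (pfaffian∞ B i j u)                  ∎
    where
    listing₂ : Inserted j (i ∷ []) (members K (pair i j))
    listing₂ = members-pair j≢i
    listing₃ : Inserted u (members K (pair i j)) (members K (triple i j u))
    listing₃ = members-triple u≢i u≢j
    size≤4 : List.length (members K (true ∷ triple i j u)) ≤ 4
    size≤4 = ≡.subst (_≤ 4)
      (≡.sym (≡.cong suc (≡.trans (length-map suc (members K (triple i j u)))
        (≡.trans (Inserted-length listing₃) (≡.cong suc (Inserted-length listing₂))))))
      ℕ.≤-refl

module ClosureClasses {a r s : Level} {V : Set a} (_≟_ : DecidableEquality V)
         (R : Rel V r) (Agree : V → Rel V s)
         (agree-equivalence : ∀ u → IsEquivalence (Agree u))
         (step : ∀ {k m u} → m ≢ k → u ≢ k → u ≢ m → R k m → ¬ R k u → ¬ R m u → Agree u k m)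
         where
  module Agree u = IsEquivalence (agree-equivalence u)

  along-path : ∀ {x k l u} → ¬ Star R x u → Star R x k → Star R k l → Agree u k l
  along-path u∉ x→k ε = Agree.refl _
  along-path {x} {k} {u = u} u∉ x→k (_◅_ {j = m} k→m m→l) =
    Agree.trans u first-step (along-path u∉ x→m m→l)
    where
    x→m : Star R x m
    x→m = x→k ◅◅ k→m ◅ ε
    first-step : Agree u k m
    first-step with m ≟ k
    ... | yes ≡.refl = Agree.refl u
    ... | no m≢k = step m≢k
      (λ u≡k → u∉ (≡.subst (Star R x) (≡.sym u≡k) x→k))
      (λ u≡m → u∉ (≡.subst (Star R x) (≡.sym u≡m) x→m))
      k→m
      (λ k→u → u∉ (x→k ◅◅ k→u ◅ ε))
      (λ m→u → u∉ (x→m ◅◅ m→u ◅ ε))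

  class-agreement : ∀ {x i j u} → Star R x i → Star R x j → ¬ Star R x u → Agree u i j
  class-agreement x→i x→j u∉ =
    Agree.trans _ (Agree.sym _ (along-path u∉ ε x→i)) (along-path u∉ ε x→j)

module Clans {c ℓ : Level} (K : Field c ℓ) (char≠2 : CharNot2 K) {n : ℕ} (A B : Matrix K n)
             (skewA : SkewSymmetric K A) (skewB : SkewSymmetric K B) (denseA : Dense K A)
             (hl : HLEquiv≤ K 4 (_^∞ K A) (_^∞ K B)) where
  open Field K hiding (zero)
  open Determinants K
  open FieldFacts K
  open HLConsequences K (skew⇒alternating char≠2 skewA) (skew⇒alternating char≠2 skewB) hl
  open import Algebra.Properties.Ring ring using (-‿involutive; +-inverseˡ-unique)
  open import Relation.Binary.Reasoning.Setoid setoid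

  Indistinguishable : Matrix K n → Fin n → Rel (Fin n) ℓ
  Indistinguishable M u = (_≈_ on M u) ∩ (_≈_ on λ k → M k u)

  Agree : Fin n → Rel (Fin n) ℓ
  Agree u = Indistinguishable A u ∩ Indistinguishable B u

  agree-equivalence : ∀ u → IsEquivalence (Agree u)
  agree-equivalence u = ∩.isEquivalence (indistinguishable-equivalence A) (indistinguishable-equivalence B)
    where
    indistinguishable-equivalence : ∀ M → IsEquivalence (Indistinguishable M u)
    indistinguishable-equivalence M =
      ∩.isEquivalence (On.isEquivalence (M u) isEquivalence) (On.isEquivalence (λ k → M k u) isEquivalence)

  column⇒indistinguishable : ∀ {M : Matrix K n} {k m u} → SkewSymmetric K M →
                             M k u ≈ M m u → Indistinguishable M u k m
  column⇒indistinguishable {M} {k} {m} {u} skew Mku≈Mmu =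
    trans (skew u k) (trans (-‿cong Mku≈Mmu) (sym (skew u m))) , Mku≈Mmu

  negate : ∀ {a b} → a ≈ - b → b ≈ - a
  negate {a} {b} a≈-b = trans (sym (-‿involutive b)) (-‿cong (sym a≈-b))

  E-step : ∀ {k m u} → m ≢ k → u ≢ k → u ≢ m →
           A k m ≈ B k m → ¬ A k u ≈ B k u → ¬ A m u ≈ B m u → Agree u k m
  E-step {k} {m} {u} m≢k u≢k u≢m Akm≈Bkm Aku≉Bku Amu≉Bmu =
    column⇒indistinguishable skewA Aku≈Amu , column⇒indistinguishable skewB Bku≈Bmu
    where
    Bku≈-Aku : B k u ≈ - A k u
    Bku≈-Aku = negate (squares-opposite (entries-square u≢k) Aku≉Bku)
    Bmu≈-Amu : B m u ≈ - A m u
    Bmu≈-Amu = negate (squares-opposite (entries-square u≢m) Amu≉Bmu)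
    Aku≈Amu : A k u ≈ A m u
    Aku≈Amu = pf-sign-change char≠2 (denseA k m (≡.≢-sym m≢k)) (begin
      square (pfaffian∞ A k m u)                    ≈⟨ pfaffians-square m≢k u≢k u≢m ⟩
      square (pfaffian∞ B k m u)                    ≈⟨ square-cong (pf-cong (sym Akm≈Bkm) Bku≈-Aku Bmu≈-Amu) ⟩
      square (pf (A k m) (- A k u) (- A m u))       ∎)
    Bku≈Bmu : B k u ≈ B m u
    Bku≈Bmu = trans Bku≈-Aku (trans (-‿cong Aku≈Amu) (sym Bmu≈-Amu))

  D-step : ∀ {k m u} → m ≢ k → u ≢ k → u ≢ m →
           A k m ≈ - B k m → ¬ A k u ≈ - B k u → ¬ A m u ≈ - B m u → Agree u k m
  D-step {k} {m} {u} m≢k u≢k u≢m Akm≈-Bkm Aku≉-Bku Amu≉-Bmu =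
    column⇒indistinguishable skewA Aku≈Amu , column⇒indistinguishable skewB Bku≈Bmu
    where
    Aku≈Bku : A k u ≈ B k u
    Aku≈Bku = squares-equal (entries-square u≢k) (λ sum≈0 → Aku≉-Bku (+-inverseˡ-unique _ _ sum≈0))
    Amu≈Bmu : A m u ≈ B m u
    Amu≈Bmu = squares-equal (entries-square u≢m) (λ sum≈0 → Amu≉-Bmu (+-inverseˡ-unique _ _ sum≈0))
    Aku≈Amu : A k u ≈ A m u
    Aku≈Amu = pf-sign-change′ char≠2 (denseA k m (≡.≢-sym m≢k)) (begin
      square (pfaffian∞ A k m u)                    ≈⟨ pfaffians-square m≢k u≢k u≢m ⟩
      square (pfaffian∞ B k m u)                    ≈⟨ square-cong (pf-cong (negate Akm≈-Bkm) (sym Aku≈Bku) (sym Amu≈Bmu)) ⟩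
      square (pf (- A k m) (A k u) (A m u))         ∎)
    Bku≈Bmu : B k u ≈ B m u
    Bku≈Bmu = trans (sym Aku≈Bku) (trans Aku≈Amu Amu≈Bmu)

  classes-are-clans : (R : Rel (Fin n) ℓ) →
    (∀ {k m u} → m ≢ k → u ≢ k → u ≢ m → R k m → ¬ R k u → ¬ R m u → Agree u k m) →
    ∀ x → IsClan K A (Star R x) × IsClan K B (Star R x)
  classes-are-clans R step x =
    (λ i j u x→i x→j u∉ → proj₁ (class-agreement x→i x→j u∉)) ,
    (λ i j u x→i x→j u∉ → proj₂ (class-agreement x→i x→j u∉))
    where open ClosureClasses Fin._≟_ R Agree agree-equivalence step

lemma6 : {c ℓ : Level} (K : Field c ℓ) → CharNot2 K → (n : ℕ) → 3 ≤ n →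
    (A B : Matrix K n) →
    SkewSymmetric K A → SkewSymmetric K B → Dense K A → Dense K B →
    HLEquiv≤ K 4 (_^∞ K A) (_^∞ K B) →
    (x : Fin n) →
      (IsClan K A (E-rel K A B x) × IsClan K B (E-rel K A B x))
      × (IsClan K A (D-rel K A B x) × IsClan K B (D-rel K A B x))
-- Every class is a Star-class of the E- or D-steps.
lemma6 K char≠2 _ _ A B skewA skewB denseA _ hl x =
  classes-are-clans (λ k m → A k m ≈ B k m) E-step x ,
  classes-are-clans (λ k m → A k m ≈ - B k m) D-step x
  where
  open Field K using (_≈_; -_)
  open Clans K char≠2 A B skewA skewB denseA hl
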